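{- Let $G$ be a finite cyclic group of even order and let $w$ be its unique involution. (i) If $w$ is a resolving involution of $G$, then $|G|=2p^m$ or $|G|=2^mp$ for some positive integer $m$ and odd prime $p$. (ii) If $|G|=2p^m$ with $p$ an odd prime and $m\ge1$, then $w$ is a resolving involution, and for any $x,y\in G\setminus\overline{w}$ with $R\{x,y\}=\{x,y,w\}$ one has $\{o(x),o(y)\}\in\{\{1,p\},\{2p^m,p\}\}$. (iii) If $|G|=2^mp$ with $p$ an odd prime and $m\ge 2$, then $w$ is a resolving involution, and for any $x,y\in G\setminus\overline{w}$ with $R\{x,y\}=\{x,y,w\}$ one has $\{o(x),o(y)\}=\{2p,p\}$.
   Context: $o(g)$ is the order of $g$. $\mathcal P_G$ is the power graph of $G$ (vertex set $G$, distinct elements adjacent iff one is a power of the other), with graph distance $d_{\mathcal P_G}$. $R\{x,y\}=\{z\in G: d_{\mathcal P_G}(x,z)\ne d_{\mathcal P_G}(y,z)\}$. $N(x)$, $N[x]$ are the open and closed neighbourhoods of $x$ in $\mathcal P_G$; $x\equiv y$ iff $N(x)=N(y)$ or $N[x]=N[y]$, and $\overline{x}$ is the equivalence class of $x$. A resolving involution of $G$ is an element $w$ of order $2$ for which there exist $x,y\in G\setminus\overline{w}$ with $R\{x,y\}=\{x,y,w\}$. -}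

module Defs where

open import Data.Nat using (ℕ; zero; suc; _*_; _<_; _≤_; NonZero)
open import Data.Nat.DivMod using (_%_)
open import Data.Fin using (Fin; toℕ)
open import Data.Product using (_×_; ∃; ∃₂)
open import Data.Sum using (_⊎_)
open import Relation.Nullary using (¬_)
open import Relation.Binary.PropositionalEquality using (_≡_)
open import Function.Bundles using (_⇔_)

-- The finite cyclic group of order n is modelled as ℤ/nℤ, carrier Fin n,
-- written additively: the k-th power of g is k · g = (k * g) mod n.
module _ (n : ℕ) .{{_ : NonZero n}} where

  _·_ : ℕ → Fin n → ℕ
  k · g = (k * toℕ g) % n

  IsPowerOf : Fin n → Fin n → Set
  IsPowerOf y x = ∃ λ k → toℕ y ≡ k · x

  Adj : Fin n → Fin n → Set
  Adj x y = ¬ (x ≡ y) × (IsPowerOf y x ⊎ IsPowerOf x y)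

  data Walk : Fin n → Fin n → ℕ → Set where
    here : ∀ {x} → Walk x x 0
    step : ∀ {x y z k} → Adj x y → Walk y z k → Walk x z (suc k)

  Dist : Fin n → Fin n → ℕ → Set
  Dist x z d = Walk x z d × (∀ d' → d' < d → ¬ Walk x z d')

  InR : Fin n → Fin n → Fin n → Set
  InR x y z = ∃₂ λ d e → Dist x z d × Dist y z e × ¬ (d ≡ e)

  -- x ≡ y (same open or same closed neighbourhood); x ∈ overline y
  Equiv : Fin n → Fin n → Set
  Equiv x y = (∀ z → Adj x z ⇔ Adj y z)
            ⊎ (∀ z → (z ≡ x ⊎ Adj x z) ⇔ (z ≡ y ⊎ Adj y z))

  IsOrder : Fin n → ℕ → Set
  IsOrder g k = 0 < k × k · g ≡ 0 × (∀ j → 0 < j → j · g ≡ 0 → k ≤ j)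

  ResolvingPair : Fin n → Fin n → Fin n → Set
  ResolvingPair w x y =
    ¬ Equiv x w × ¬ Equiv y w ×
    (∀ z → InR x y z ⇔ (z ≡ x ⊎ z ≡ y ⊎ z ≡ w))

  IsResolvingInvolution : Fin n → Set
  IsResolvingInvolution w = IsOrder w 2 × ∃₂ λ x y → ResolvingPair w x y

SameSet : ℕ → ℕ → ℕ → ℕ → Set
SameSet a b c d = (a ≡ c × b ≡ d) ⊎ (a ≡ d × b ≡ c)

-- In ℤ/n two distinct elements are adjacent in the power graph iff their orders divide one
-- another, and every element is adjacent to 0, so all distances are 0, 1 or 2 and are read off
-- the orders.  If R{x,y} = {x,y,w}, then w separates x from y, so exactly one of the orders, say
-- a = o(x), is comparable with 2 under divisibility while b = o(y) is not; and since every divisor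
-- d ≥ 3 of n is the order of at least two elements, one of which avoids x and y, a and b are
-- comparable with exactly the same divisors d ≥ 3 of n.  Elementary divisor arithmetic then forces
-- b to be an odd prime p and either n = 2pˢ with a ∈ {1, n}, or n = 2ᵏp (k ≥ 2) with a = 2p.
-- Conversely these orders satisfy the divisor condition, and a second element of order p, adjacent
-- to x and y but not to w, shows that x and y are not equivalent to w.
module Submission where

open import Defs
open import Data.Nat
open import Data.Nat.Properties
open import Data.Nat.Divisibility
open import Data.Nat.DivMod using (_%_; %-remove-+ʳ; m<n⇒m%n≡m; m*n%n≡0)
open import Data.Nat.GCD
open import Data.Nat.Induction using (<-rec)
open import Data.Nat.Primality
open import Data.Nat.Coprimality using (Coprime; coprime-divisor)
open import Data.Nat.Solver using (module +-*-Solver)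
open import Data.Fin using (Fin; toℕ; fromℕ<) renaming (_≟_ to _≟ᶠ_)
open import Data.Fin.Properties using (toℕ-fromℕ<; toℕ<n; toℕ-injective)
open import Data.Product using (_×_; _,_; ∃; ∃₂)
open import Data.Sum using (_⊎_; inj₁; inj₂; [_,_]′; swap) renaming (map to map⊎)
open import Data.Empty using (⊥-elim)
open import Function.Base using (id; _∘_)
open import Function.Bundles using (_⇔_; mk⇔; Equivalence)
open import Function.Properties.Equivalence using () renaming (sym to ⇔-sym)
open import Relation.Nullary
open import Relation.Nullary.Decidable using (decidable-stable; _⊎-dec_)
open import Relation.Binary.PropositionalEquality
open import Relation.Binary.Definitions using (tri<; tri≈; tri>)

Comparable : ℕ → ℕ → Set
Comparable a b = a ∣ b ⊎ b ∣ a

comparable? : ∀ a b → Dec (Comparable a b)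
comparable? a b = (a ∣? b) ⊎-dec (b ∣? a)

∣-nonZero : ∀ {d n} .{{_ : NonZero n}} → d ∣ n → NonZero d
∣-nonZero {n = n} d∣n = ≢-nonZero λ { refl → ≢-nonZero⁻¹ n (0∣⇒≡0 d∣n) }

odd⇒3≤ : ∀ {e} → 1 < e → ¬ 2 ∣ e → 3 ≤ e
odd⇒3≤ {suc zero} (s≤s ()) _
odd⇒3≤ {suc (suc zero)} _ 2∤e = ⊥-elim (2∤e ∣-refl)
odd⇒3≤ {suc (suc (suc _))} _ _ = s≤s (s≤s (s≤s z≤n))

prime⇒≢1 : ∀ {p} → Prime p → p ≢ 1
prime⇒≢1 pp = nonTrivial⇒≢1 {{prime⇒nonTrivial pp}}

¬comparable-2⇒3≤ : ∀ {b} .{{_ : NonZero b}} → ¬ Comparable 2 b → 3 ≤ b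
¬comparable-2⇒3≤ {suc zero} 2≁1 = ⊥-elim (2≁1 (inj₂ (1∣ 2)))
¬comparable-2⇒3≤ {suc (suc zero)} 2≁2 = ⊥-elim (2≁2 (inj₁ ∣-refl))
¬comparable-2⇒3≤ {suc (suc (suc _))} _ = s≤s (s≤s (s≤s z≤n))

prime∤⇒coprime : ∀ {p d} → Prime p → ¬ p ∣ d → Coprime d p
prime∤⇒coprime pp p∤d (i∣d , i∣p) with prime⇒irreducible pp i∣p
... | inj₁ i≡1 = i≡1
... | inj₂ refl = ⊥-elim (p∤d i∣d)

prime∤∧∣*⇒∣ : ∀ {p d c} → Prime p → ¬ p ∣ d → d ∣ p * c → d ∣ c
prime∤∧∣*⇒∣ pp p∤d = coprime-divisor (prime∤⇒coprime pp p∤d)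

prime∤∧∣^*⇒∣ : ∀ {p d c} m → Prime p → ¬ p ∣ d → d ∣ p ^ m * c → d ∣ c
prime∤∧∣^*⇒∣ {p} {d} {c} zero pp p∤d d∣c = subst (d ∣_) (*-identityˡ c) d∣c
prime∤∧∣^*⇒∣ {p} {d} {c} (suc m) pp p∤d d∣pp^mc =
  prime∤∧∣^*⇒∣ m pp p∤d (prime∤∧∣*⇒∣ pp p∤d (subst (d ∣_) (*-assoc p (p ^ m) c) d∣pp^mc))

odd∧∣2*⇒∣ : ∀ {d c} → ¬ 2 ∣ d → d ∣ 2 * c → d ∣ c
odd∧∣2*⇒∣ = prime∤∧∣*⇒∣ prime[2]

prime∣prime^⇒≡ : ∀ {r p} m → Prime r → Prime p → r ∣ p ^ m → r ≡ p
prime∣prime^⇒≡ zero pr pp r∣1 = ⊥-elim (prime⇒≢1 pr (∣1⇒≡1 r∣1))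
prime∣prime^⇒≡ {r} {p} (suc m) pr pp r∣p^[1+m] with euclidsLemma p (p ^ m) pr r∣p^[1+m]
... | inj₂ r∣p^m = prime∣prime^⇒≡ m pr pp r∣p^m
... | inj₁ r∣p with prime⇒irreducible pp r∣p
...   | inj₁ r≡1 = ⊥-elim (prime⇒≢1 pr r≡1)
...   | inj₂ r≡p = r≡p

divisors-multiples⇒power : ∀ {q} → 1 < q → ∀ c → .{{NonZero c}} →
  (∀ {e} → e ∣ c → 1 < e → q ∣ e) → ∃ λ s → c ≡ q ^ s
divisors-multiples⇒power {q} 1<q = <-rec P go
  where
  P : ℕ → Set
  P c = .{{NonZero c}} → (∀ {e} → e ∣ c → 1 < e → q ∣ e) → ∃ λ s → c ≡ q ^ s
  go : ∀ c → (∀ {c'} → c' < c → P c') → P c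
  go c rec multiples with c ≟ 1
  ... | yes refl = 0 , refl
  ... | no c≢1 with multiples ∣-refl (≤∧≢⇒< (>-nonZero⁻¹ c) (λ 1≡c → c≢1 (sym 1≡c)))
  ...   | divides c' refl =
    let instance _ = m*n≢0⇒m≢0 c'
        s , c'≡q^s = rec (m<m*n c' q 1<q) (λ e∣c' → multiples (∣-trans e∣c' (m∣m*n q)))
    in suc s , trans (cong (_* q) c'≡q^s) (*-comm (q ^ s) q)

prime-if-divisors-multiples : ∀ {b} → 1 < b → (∀ {e} → e ∣ b → 1 < e → b ∣ e) → Prime b
prime-if-divisors-multiples {b} 1<b multiples =
  irreducible⇒prime {{n>1⇒nonTrivial 1<b}} irreducible
  where
  instance
    b≢0 : NonZero b
    b≢0 = >-nonZero (<-trans z<s 1<b)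
  irreducible : Irreducible b
  irreducible {e} e∣b with e ≟ 1
  ... | yes e≡1 = inj₁ e≡1
  ... | no e≢1 = inj₂ (∣-antisym e∣b (multiples e∣b 1<e))
    where
    instance
      e≢0 : NonZero e
      e≢0 = ∣-nonZero e∣b
    1<e : 1 < e
    1<e = ≤∧≢⇒< (>-nonZero⁻¹ e) (λ 1≡e → e≢1 (sym 1≡e))

1<⇒3≤2* : ∀ {e} → 1 < e → 3 ≤ 2 * e
1<⇒3≤2* {e} 1<e = ≤-trans (s≤s (s≤s (s≤s z≤n))) (*-monoʳ-≤ 2 1<e)

-- The arithmetic content of d(x, z) = d(y, z) for all z of order d ≥ 3, where a = o(x), b = o(y).
SameComparableDivisors : ℕ → ℕ → ℕ → Set
SameComparableDivisors n a b = ∀ {d} → d ∣ n → 3 ≤ d → Comparable d a ⇔ Comparable d b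

sameComparableDivisors-sym : ∀ {n a b} → SameComparableDivisors n a b → SameComparableDivisors n b a
sameComparableDivisors-sym same d∣n 3≤d = ⇔-sym (same d∣n 3≤d)

-- The orders a = o(x), b = o(y) of a resolving pair, x being the element whose order is comparable with 2.
data ResolvingOrders (n a b : ℕ) : Set where
  twice-prime-power : Prime b → ¬ 2 ∣ b → ∀ s → 1 ≤ s → n ≡ 2 * b ^ s → a ≡ 1 ⊎ a ≡ n →
    ResolvingOrders n a b
  prime-times-power-of-two : Prime b → ¬ 2 ∣ b → ∀ k → 2 ≤ k → n ≡ 2 ^ k * b → a ≡ 2 * b →
    ResolvingOrders n a b

module ResolvingOrdersArithmetic {n a b : ℕ} .{{_ : NonZero n}}
  (2∣n : 2 ∣ n) (a∣n : a ∣ n) (b∣n : b ∣ n)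
  (a≢2 : a ≢ 2) (2~a : Comparable 2 a) (2≁b : ¬ Comparable 2 b)
  (same : SameComparableDivisors n a b) where

  private
    forward : ∀ {d} → d ∣ n → 3 ≤ d → Comparable d a → Comparable d b
    forward d∣n 3≤d = Equivalence.to (same d∣n 3≤d)

    backward : ∀ {d} → d ∣ n → 3 ≤ d → Comparable d b → Comparable d a
    backward d∣n 3≤d = Equivalence.from (same d∣n 3≤d)

    b-odd : ¬ 2 ∣ b
    b-odd 2∣b = 2≁b (inj₁ 2∣b)

    b∤2 : ¬ b ∣ 2
    b∤2 b∣2 = 2≁b (inj₂ b∣2)

    instance
      b≢0 : NonZero b
      b≢0 = ∣-nonZero b∣n

    3≤b : 3 ≤ b
    3≤b = ¬comparable-2⇒3≤ 2≁b

    1<b : 1 < b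
    1<b = ≤-trans (s≤s (s≤s z≤n)) 3≤b

    c : ℕ
    c = quotient 2∣n

    n≡2c : n ≡ 2 * c
    n≡2c = m∣n⇒n≡m*quotient 2∣n

    instance
      c≢0 : NonZero c
      c≢0 = ∣-nonZero (divides 2 n≡2c)

    b∣c : b ∣ c
    b∣c = odd∧∣2*⇒∣ b-odd (subst (b ∣_) n≡2c b∣n)

    b∣-if-comparable-2* : ∀ {e} → Comparable (2 * e) b → b ∣ e
    b∣-if-comparable-2* {e} (inj₁ 2e∣b) = ⊥-elim (b-odd (∣-trans (m∣m*n e) 2e∣b))
    b∣-if-comparable-2* (inj₂ b∣2e) = odd∧∣2*⇒∣ b-odd b∣2e

    module EvenOrder (a' : ℕ) (a≡2a' : a ≡ 2 * a') where

      b∣a' : b ∣ a'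
      b∣a' with backward b∣n 3≤b (inj₁ ∣-refl)
      ... | inj₁ b∣a = odd∧∣2*⇒∣ b-odd (subst (b ∣_) a≡2a' b∣a)
      ... | inj₂ a∣b = ⊥-elim (b-odd (∣-trans (divides a' (trans a≡2a' (*-comm 2 a'))) a∣b))

      a'∣c : a' ∣ c
      a'∣c = *-cancelˡ-∣ 2 (subst₂ _∣_ a≡2a' n≡2c a∣n)

      -- Test with d = n/2, a multiple of b.
      a≡n : ¬ 2 ∣ c → a ≡ n
      a≡n c-odd = begin
          a      ≡⟨ a≡2a' ⟩
          2 * a' ≡⟨ cong (2 *_) (∣-antisym a'∣c c∣a') ⟩
          2 * c  ≡⟨ sym n≡2c ⟩
          n      ∎
        where
        open ≡-Reasoning
        c∣a' : c ∣ a'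
        c∣a' with backward (divides 2 n≡2c) (≤-trans 3≤b (∣⇒≤ b∣c)) (inj₂ b∣c)
        ... | inj₁ c∣a = odd∧∣2*⇒∣ c-odd (subst (c ∣_) a≡2a' c∣a)
        ... | inj₂ a∣c = ⊥-elim (c-odd (∣-trans (subst (2 ∣_) (sym a≡2a') (m∣m*n a')) a∣c))

      -- Test with d = 4, which rules out 4 ∣ a, and with d = 4b.
      a≡2b : 4 ∣ n → a ≡ 2 * b
      a≡2b (divides t n≡t4) = trans a≡2a' (cong (2 *_) (∣-antisym a'∣b b∣a'))
        where
        4∤a : ¬ 4 ∣ a
        4∤a 4∣a with forward (∣-trans 4∣a a∣n) (s≤s (s≤s (s≤s z≤n))) (inj₁ 4∣a)
        ... | inj₁ 4∣b = b-odd (∣-trans (m∣m*n 2) 4∣b)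
        ... | inj₂ b∣4 = b∤2 (odd∧∣2*⇒∣ b-odd b∣4)
        a'-odd : ¬ 2 ∣ a'
        a'-odd 2∣a' = 4∤a (subst (4 ∣_) (sym a≡2a') (*-monoʳ-∣ 2 2∣a'))
        n≡2[2t] : n ≡ 2 * (2 * t)
        n≡2[2t] = trans n≡t4 (trans (*-comm t 4) (*-assoc 2 2 t))
        b∣t : b ∣ t
        b∣t = odd∧∣2*⇒∣ b-odd (odd∧∣2*⇒∣ b-odd (subst (b ∣_) n≡2[2t] b∣n))
        4b∣n : 4 * b ∣ n
        4b∣n = subst (4 * b ∣_) (trans (*-comm 4 t) (sym n≡t4)) (*-monoʳ-∣ 4 b∣t)
        a'∣b : a' ∣ b
        a'∣b with backward 4b∣n (≤-trans 3≤b (m≤n*m b 4)) (inj₂ (n∣m*n 4))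
        ... | inj₁ 4b∣a = ⊥-elim (4∤a (∣-trans (m∣m*n b) 4b∣a))
        ... | inj₂ a∣4b =
          odd∧∣2*⇒∣ a'-odd (*-cancelˡ-∣ 2 (subst₂ _∣_ a≡2a' (*-assoc 2 2 b) a∣4b))

    a-cases : (a ≡ 1 ⊎ a ≡ n) ⊎ (4 ∣ n × a ≡ 2 * b)
    a-cases = [ even , divides-2 ]′ 2~a
      where
      divides-2 : a ∣ 2 → (a ≡ 1 ⊎ a ≡ n) ⊎ (4 ∣ n × a ≡ 2 * b)
      divides-2 a∣2 with prime⇒irreducible prime[2] a∣2
      ... | inj₁ a≡1 = inj₁ (inj₁ a≡1)
      ... | inj₂ a≡2 = ⊥-elim (a≢2 a≡2)
      even : 2 ∣ a → (a ≡ 1 ⊎ a ≡ n) ⊎ (4 ∣ n × a ≡ 2 * b)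
      even (divides a' a≡a'2) with 4 ∣? n
      ... | yes 4∣n = inj₂ (4∣n , EvenOrder.a≡2b a' (trans a≡a'2 (*-comm a' 2)) 4∣n)
      ... | no 4∤n = inj₁ (inj₂ (EvenOrder.a≡n a' (trans a≡a'2 (*-comm a' 2)) c-odd))
        where
        c-odd : ¬ 2 ∣ c
        c-odd 2∣c = 4∤n (subst (4 ∣_) (sym n≡2c) (*-monoʳ-∣ 2 2∣c))

    comparable-a : a ≡ 1 ⊎ a ≡ n → ∀ {d} → d ∣ n → Comparable d a
    comparable-a a∈1n {d} d∣n =
      [ (λ a≡1 → inj₂ (subst (_∣ d) (sym a≡1) (1∣ d)))
      , (λ a≡n → inj₁ (subst (d ∣_) (sym a≡n) d∣n)) ]′ a∈1n

    b∣divisor-of-c : a ≡ 1 ⊎ a ≡ n → ∀ {e} → e ∣ c → 1 < e → b ∣ e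
    b∣divisor-of-c a∈1n {e} e∣c 1<e =
      b∣-if-comparable-2* (forward 2e∣n (1<⇒3≤2* 1<e) (comparable-a a∈1n 2e∣n))
      where
      2e∣n : 2 * e ∣ n
      2e∣n = subst (2 * e ∣_) (sym n≡2c) (*-monoʳ-∣ 2 e∣c)

    twice-prime-power-case : a ≡ 1 ⊎ a ≡ n → ResolvingOrders n a b
    twice-prime-power-case a∈1n with divisors-multiples⇒power 1<b c (b∣divisor-of-c a∈1n)
    ... | zero , c≡1 = ⊥-elim (b∤2 (subst (b ∣_) (trans n≡2c (cong (2 *_) c≡1)) b∣n))
    ... | suc s , c≡b^[1+s] = twice-prime-power
      (prime-if-divisors-multiples 1<b (λ e∣b → b∣divisor-of-c a∈1n (∣-trans e∣b b∣c)))
      b-odd (suc s) (s≤s z≤n) (trans n≡2c (cong (2 *_) c≡b^[1+s])) a∈1n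

    module PrimeTimesPowerOfTwo (a≡2b : a ≡ 2 * b) where

      b∣divisor-of-b : ∀ {e} → e ∣ b → 1 < e → b ∣ e
      b∣divisor-of-b {e} e∣b 1<e =
        b∣-if-comparable-2* (forward (∣-trans 2e∣a a∣n) (1<⇒3≤2* 1<e) (inj₁ 2e∣a))
        where
        2e∣a : 2 * e ∣ a
        2e∣a = subst (2 * e ∣_) (sym a≡2b) (*-monoʳ-∣ 2 e∣b)

      r : ℕ
      r = quotient b∣n

      n≡rb : n ≡ r * b
      n≡rb = m∣n⇒n≡quotient*m b∣n

      instance
        r≢0 : NonZero r
        r≢0 = ∣-nonZero (divides b (trans n≡rb (*-comm r b)))

      -- An odd e > 1 would make e·b comparable with b but not with 2b.
      2∣divisor-of-r : ∀ {e} → e ∣ r → 1 < e → 2 ∣ e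
      2∣divisor-of-r {e} e∣r 1<e = decidable-stable (2 ∣? e) λ e-odd →
        [ (λ eb∣a → <⇒≱ (odd⇒3≤ 1<e e-odd) (∣⇒≤ (*-cancelʳ-∣ b (subst (e * b ∣_) a≡2b eb∣a))))
        , (λ a∣eb → e-odd (*-cancelʳ-∣ b (subst (_∣ e * b) a≡2b a∣eb))) ]′
        (backward (subst (e * b ∣_) (sym n≡rb) (*-monoˡ-∣ b e∣r))
          (≤-trans (odd⇒3≤ 1<e e-odd) (m≤m*n e b)) (inj₂ (n∣m*n e)))

      resolvingOrders-if : 4 ∣ n → ResolvingOrders n a b
      resolvingOrders-if 4∣n with divisors-multiples⇒power (s≤s (s≤s z≤n)) r 2∣divisor-of-r
      ... | zero , r≡1 =
        ⊥-elim (b-odd (subst (2 ∣_) (trans n≡rb (trans (cong (_* b) r≡1) (*-identityˡ b))) 2∣n))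
      ... | suc zero , r≡2 =
        ⊥-elim (b-odd (*-cancelˡ-∣ 2 (subst (4 ∣_) (trans n≡rb (cong (_* b) r≡2)) 4∣n)))
      ... | suc (suc k) , r≡2^[2+k] = prime-times-power-of-two
        (prime-if-divisors-multiples 1<b b∣divisor-of-b)
        b-odd (suc (suc k)) (s≤s (s≤s z≤n)) (trans n≡rb (cong (_* b) r≡2^[2+k])) a≡2b

  resolvingOrders : ResolvingOrders n a b
  resolvingOrders =
    [ twice-prime-power-case
    , (λ (4∣n , a≡2b) → PrimeTimesPowerOfTwo.resolvingOrders-if a≡2b 4∣n) ]′ a-cases

p∣p^m : ∀ {p m} → 1 ≤ m → p ∣ p ^ m
p∣p^m {p} {suc m} _ = m∣m*n (p ^ m)

4∣2^k : ∀ {k} → 2 ≤ k → 4 ∣ 2 ^ k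
4∣2^k {suc zero} (s≤s ())
4∣2^k {suc (suc k)} _ = divides (2 ^ k) (trans (sym (*-assoc 2 2 (2 ^ k))) (*-comm 4 (2 ^ k)))

odd-prime⇒2≁ : ∀ {p} → Prime p → ¬ 2 ∣ p → ¬ Comparable 2 p
odd-prime⇒2≁ pp 2∤p (inj₁ 2∣p) = 2∤p 2∣p
odd-prime⇒2≁ pp 2∤p (inj₂ p∣2) with prime⇒irreducible prime[2] p∣2
... | inj₁ p≡1 = prime⇒≢1 pp p≡1
... | inj₂ refl = 2∤p ∣-refl

sameComparableDivisors-2p^m : ∀ {n p m} → Prime p → n ≡ 2 * p ^ m → SameComparableDivisors n 1 p
sameComparableDivisors-2p^m {n} {p} {m} pp n≡2p^m {d} d∣n 3≤d =
  mk⇔ (λ _ → inj₂ p∣d) (λ _ → inj₂ (1∣ d))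
  where
  p∣d : p ∣ d
  p∣d = decidable-stable (p ∣? d) λ p∤d →
    <⇒≱ 3≤d (∣⇒≤ (prime∤∧∣^*⇒∣ m pp p∤d (subst (d ∣_) (trans n≡2p^m (*-comm 2 (p ^ m))) d∣n)))

sameComparableDivisors-2^mp : ∀ {n p m} → Prime p → ¬ 2 ∣ p → n ≡ 2 ^ m * p →
  SameComparableDivisors n (2 * p) p
sameComparableDivisors-2^mp {n} {p} {m} pp 2∤p n≡2^mp {d} d∣n 3≤d with p ∣? d
... | yes p∣d@(divides t d≡tp) = mk⇔ (λ _ → inj₂ p∣d) (λ _ → d~2p)
  where
  d~2p : Comparable d (2 * p)
  d~2p with 2 ∣? d
  ... | no 2∤d = inj₁ (∣n⇒∣m*n 2 (prime∤∧∣^*⇒∣ m prime[2] 2∤d (subst (d ∣_) n≡2^mp d∣n)))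
  ... | yes 2∣d with euclidsLemma t p prime[2] (subst (2 ∣_) d≡tp 2∣d)
  ...   | inj₁ 2∣t = inj₂ (subst (2 * p ∣_) (sym d≡tp) (*-monoˡ-∣ p 2∣t))
  ...   | inj₂ 2∣p = ⊥-elim (2∤p 2∣p)
... | no p∤d = mk⇔ (⊥-elim ∘ d≁2p) (⊥-elim ∘ d≁p)
  where
  d≁p : ¬ Comparable d p
  d≁p (inj₂ p∣d) = p∤d p∣d
  d≁p (inj₁ d∣p) with prime⇒irreducible pp d∣p
  ... | inj₁ refl = <⇒≱ 3≤d (s≤s z≤n)
  ... | inj₂ refl = p∤d ∣-refl
  d≁2p : ¬ Comparable d (2 * p)
  d≁2p (inj₁ d∣2p) = <⇒≱ 3≤d (∣⇒≤ (prime∤∧∣*⇒∣ pp p∤d (subst (d ∣_) (*-comm 2 p) d∣2p)))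
  d≁2p (inj₂ 2p∣d) = p∤d (∣-trans (n∣m*n 2) 2p∣d)

sameSet-swap : ∀ {a b c d} → SameSet a b c d → SameSet b a c d
sameSet-swap (inj₁ (a≡c , b≡d)) = inj₂ (b≡d , a≡c)
sameSet-swap (inj₂ (a≡d , b≡c)) = inj₁ (b≡c , a≡d)

resolvingOrders⇒shape : ∀ {n a b} → ResolvingOrders n a b →
  ∃₂ λ p m → Prime p × ¬ (2 ∣ p) × 1 ≤ m × (n ≡ 2 * p ^ m ⊎ n ≡ 2 ^ m * p)
resolvingOrders⇒shape {b = b} (twice-prime-power pb 2∤b s 1≤s n≡2b^s _) =
  b , s , pb , 2∤b , 1≤s , inj₁ n≡2b^s
resolvingOrders⇒shape {b = b} (prime-times-power-of-two pb 2∤b k 2≤k n≡2^kb _) =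
  b , k , pb , 2∤b , ≤-trans (s≤s z≤n) 2≤k , inj₂ n≡2^kb

resolvingOrders-2p^m : ∀ {n a b p m} → Prime p → ¬ 2 ∣ p → n ≡ 2 * p ^ m →
  ResolvingOrders n a b ⊎ ResolvingOrders n b a → SameSet a b 1 p ⊎ SameSet a b (2 * p ^ m) p
resolvingOrders-2p^m {n} {p = p} {m} pp 2∤p n≡2p^m =
  [ oriented , map⊎ sameSet-swap sameSet-swap ∘ oriented ]′
  where
  oriented : ∀ {a b} → ResolvingOrders n a b → SameSet a b 1 p ⊎ SameSet a b (2 * p ^ m) p
  oriented {a} {b} (twice-prime-power pb 2∤b s 1≤s n≡2b^s a∈1n) =
    [ (λ a≡1 → inj₁ (inj₁ (a≡1 , b≡p)))
    , (λ a≡n → inj₂ (inj₁ (trans a≡n n≡2p^m , b≡p))) ]′ a∈1n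
    where
    b∣n : b ∣ n
    b∣n = subst (b ∣_) (sym n≡2b^s) (∣n⇒∣m*n 2 (p∣p^m 1≤s))
    b≡p : b ≡ p
    b≡p = prime∣prime^⇒≡ m pb pp (odd∧∣2*⇒∣ 2∤b (subst (b ∣_) n≡2p^m b∣n))
  oriented {b = b} (prime-times-power-of-two _ _ k 2≤k n≡2^kb _) =
    ⊥-elim (2∤p (subst (2 ∣_) (prime∣prime^⇒≡ m prime[2] pp 2∣p^m) ∣-refl))
    where
    2∣p^m : 2 ∣ p ^ m
    2∣p^m = *-cancelˡ-∣ 2 (subst (4 ∣_) (trans (sym n≡2^kb) n≡2p^m) (∣m⇒∣m*n b (4∣2^k 2≤k)))

resolvingOrders-2^mp : ∀ {n a b p m} → Prime p → 2 ≤ m → n ≡ 2 ^ m * p →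
  ResolvingOrders n a b ⊎ ResolvingOrders n b a → SameSet a b (2 * p) p
resolvingOrders-2^mp {n} {p = p} {m} pp 2≤m n≡2^mp = [ oriented , sameSet-swap ∘ oriented ]′
  where
  oriented : ∀ {a b} → ResolvingOrders n a b → SameSet a b (2 * p) p
  oriented {b = b} (twice-prime-power pb 2∤b s _ n≡2b^s _) =
    ⊥-elim (2∤b (subst (2 ∣_) (prime∣prime^⇒≡ s prime[2] pb 2∣b^s) ∣-refl))
    where
    2∣b^s : 2 ∣ b ^ s
    2∣b^s = *-cancelˡ-∣ 2 (subst (4 ∣_) (trans (sym n≡2^mp) n≡2b^s) (∣m⇒∣m*n p (4∣2^k 2≤m)))
  oriented {b = b} (prime-times-power-of-two pb 2∤b k _ n≡2^kb a≡2b) with prime⇒irreducible pp b∣p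
    where
    b∣p : b ∣ p
    b∣p = prime∤∧∣^*⇒∣ m prime[2] 2∤b (subst (b ∣_) (trans (sym n≡2^kb) n≡2^mp) (n∣m*n (2 ^ k)))
  ... | inj₁ b≡1 = ⊥-elim (prime⇒≢1 pb b≡1)
  ... | inj₂ b≡p = inj₁ (trans a≡2b (cong (2 *_) b≡p) , b≡p)

gcd∣⇒multiple-mod : ∀ N .{{_ : NonZero N}} x {z} → z < N → gcd x N ∣ z → ∃ λ k → (k * x) % N ≡ z
gcd∣⇒multiple-mod N x {z} z<N (divides c z≡c*g) with Bézout.identity (gcd-GCD x N)
... | Bézout.+- s t g+tN≡sx = c * s , (begin
    c * s * x % N               ≡⟨ cong (_% N) c*s*x≡c*g+c*t*N ⟩
    (c * g + c * t * N) % N     ≡⟨ %-remove-+ʳ (c * g) (n∣m*n (c * t)) ⟩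
    c * g % N                   ≡⟨ cong (_% N) (sym z≡c*g) ⟩
    z % N                       ≡⟨ m<n⇒m%n≡m z<N ⟩
    z                           ∎)
  where
  open ≡-Reasoning
  open +-*-Solver
  g : ℕ
  g = gcd x N
  c*s*x≡c*g+c*t*N : c * s * x ≡ c * g + c * t * N
  c*s*x≡c*g+c*t*N = begin
    c * s * x        ≡⟨ *-assoc c s x ⟩
    c * (s * x)      ≡⟨ cong (c *_) (sym g+tN≡sx) ⟩
    c * (g + t * N)  ≡⟨ solve 4 (λ c g t N → c :* (g :+ t :* N) := c :* g :+ c :* t :* N) refl c g t N ⟩
    c * g + c * t * N ∎
... | Bézout.-+ s t g+sx≡tN = (N ∸ 1) * (c * s) , (begin
    (N ∸ 1) * (c * s) * x % N                 ≡⟨ %-remove-+ʳ _ (n∣m*n (c * t)) ⟨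
    ((N ∸ 1) * (c * s) * x + c * t * N) % N   ≡⟨ cong (_% N) shift ⟩
    (c * g + c * s * x * N) % N               ≡⟨ %-remove-+ʳ (c * g) (n∣m*n (c * s * x)) ⟩
    c * g % N                                 ≡⟨ cong (_% N) (sym z≡c*g) ⟩
    z % N                                     ≡⟨ m<n⇒m%n≡m z<N ⟩
    z                                         ∎)
  where
  open ≡-Reasoning
  open +-*-Solver
  g : ℕ
  g = gcd x N
  N≡1+[N∸1] : N ≡ 1 + (N ∸ 1)
  N≡1+[N∸1] = sym (m+[n∸m]≡n (>-nonZero⁻¹ N))
  -- c·t·N = c·g + c·s·x, so adding it turns (N - 1)·c·s·x into c·g plus a multiple of N
  shift : (N ∸ 1) * (c * s) * x + c * t * N ≡ c * g + c * s * x * N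
  shift = begin
    (N ∸ 1) * (c * s) * x + c * t * N
      ≡⟨ cong ((N ∸ 1) * (c * s) * x +_) (*-assoc c t N) ⟩
    (N ∸ 1) * (c * s) * x + c * (t * N)
      ≡⟨ cong (λ u → (N ∸ 1) * (c * s) * x + c * u) (sym g+sx≡tN) ⟩
    (N ∸ 1) * (c * s) * x + c * (g + s * x)
      ≡⟨ solve 5 (λ M c s x g → M :* (c :* s) :* x :+ c :* (g :+ s :* x)
                             := c :* g :+ c :* s :* x :* (con 1 :+ M)) refl (N ∸ 1) c s x g ⟩
    c * g + c * s * x * (1 + (N ∸ 1))
      ≡⟨ cong (λ u → c * g + c * s * x * u) (sym N≡1+[N∸1]) ⟩
    c * g + c * s * x * N
      ∎

cofactor-∣ : ∀ {N u₁ v₁ u₂ v₂} .{{_ : NonZero N}} → N ≡ u₁ * v₁ → N ≡ u₂ * v₂ → v₁ ∣ v₂ → u₂ ∣ u₁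
cofactor-∣ {N} {u₁} {v₁} {u₂} {v₂} N≡u₁v₁ N≡u₂v₂ (divides q v₂≡qv₁) =
  divides q (*-cancelʳ-≡ u₁ (q * u₂) v₁ (begin
    u₁ * v₁       ≡⟨ sym N≡u₁v₁ ⟩
    N             ≡⟨ N≡u₂v₂ ⟩
    u₂ * v₂       ≡⟨ cong (u₂ *_) v₂≡qv₁ ⟩
    u₂ * (q * v₁) ≡⟨ sym (*-assoc u₂ q v₁) ⟩
    u₂ * q * v₁   ≡⟨ cong (_* v₁) (*-comm u₂ q) ⟩
    q * u₂ * v₁   ∎))
  where
  open ≡-Reasoning
  instance
    v₁≢0 : NonZero v₁
    v₁≢0 = ≢-nonZero λ v₁≡0 → ≢-nonZero⁻¹ N (trans N≡u₁v₁ (trans (cong (u₁ *_) v₁≡0) (*-zeroʳ u₁)))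

gcd[m,n]≡m : ∀ {m n} → m ∣ n → gcd m n ≡ m
gcd[m,n]≡m {m} {n} m∣n = ∣-antisym (gcd[m,n]∣m m n) (gcd-greatest ∣-refl m∣n)

∣m∣n⇒∣n∸m : ∀ {d m n} → d ∣ m → d ∣ n → d ∣ n ∸ m
∣m∣n⇒∣n∸m {d} (divides a refl) (divides b refl) = divides (b ∸ a) (sym (*-distribʳ-∸ d b a))

gcd[n∸m,n]≡gcd[m,n] : ∀ {m n} → m ≤ n → gcd (n ∸ m) n ≡ gcd m n
gcd[n∸m,n]≡gcd[m,n] {m} {n} m≤n = ∣-antisym
  (gcd-greatest
    (∣m+n∣m⇒∣n (subst (g ∣_) (sym (m∸n+n≡m m≤n)) (gcd[m,n]∣n (n ∸ m) n)) (gcd[m,n]∣m (n ∸ m) n))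
    (gcd[m,n]∣n (n ∸ m) n))
  (gcd-greatest (∣m∣n⇒∣n∸m (gcd[m,n]∣m m n) (gcd[m,n]∣n m n)) (gcd[m,n]∣n m n))
  where
  g : ℕ
  g = gcd (n ∸ m) n

module CyclicGroup (n : ℕ) .{{_ : NonZero n}} where

  -- index x = gcd(x, n) is the index of ⟨x⟩, so order x = n / index x is the order of x.
  index : Fin n → ℕ
  index x = gcd (toℕ x) n

  order : Fin n → ℕ
  order x = quotient (gcd[m,n]∣n (toℕ x) n)

  n≡order*index : ∀ x → n ≡ order x * index x
  n≡order*index x = m∣n⇒n≡quotient*m (gcd[m,n]∣n (toℕ x) n)

  n≡index*order : ∀ x → n ≡ index x * order x
  n≡index*order x = trans (n≡order*index x) (*-comm (order x) (index x))

  order∣n : ∀ x → order x ∣ n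
  order∣n x = divides (index x) (n≡index*order x)

  index≢0 : ∀ x → NonZero (index x)
  index≢0 x = ∣-nonZero (gcd[m,n]∣n (toℕ x) n)

  order≢0 : ∀ x → NonZero (order x)
  order≢0 x = ∣-nonZero (order∣n x)

  isPowerOf⇒order∣ : ∀ {x z} → IsPowerOf n z x → order z ∣ order x
  isPowerOf⇒order∣ {x} {z} (k , z≡k·x) =
    cofactor-∣ (n≡order*index x) (n≡order*index z) (gcd-greatest index-x∣z (gcd[m,n]∣n (toℕ x) n))
    where
    index-x∣z : index x ∣ toℕ z
    index-x∣z = subst (index x ∣_) (sym z≡k·x)
      (%-presˡ-∣ (∣n⇒∣m*n k (gcd[m,n]∣m (toℕ x) n)) (gcd[m,n]∣n (toℕ x) n))

  order∣⇒isPowerOf : ∀ {x z} → order z ∣ order x → IsPowerOf n z x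
  order∣⇒isPowerOf {x} {z} oz∣ox =
    let k , k·x≡z = gcd∣⇒multiple-mod n (toℕ x) (toℕ<n z) index-x∣z in k , sym k·x≡z
    where
    index-x∣z : index x ∣ toℕ z
    index-x∣z = ∣-trans (cofactor-∣ (n≡index*order z) (n≡index*order x) oz∣ox) (gcd[m,n]∣m (toℕ z) n)

  adj⇒comparable : ∀ {x z} → Adj n x z → Comparable (order x) (order z)
  adj⇒comparable (_ , inj₁ z-power-of-x) = inj₂ (isPowerOf⇒order∣ z-power-of-x)
  adj⇒comparable (_ , inj₂ x-power-of-z) = inj₁ (isPowerOf⇒order∣ x-power-of-z)

  comparable⇒adj : ∀ {x z} → x ≢ z → Comparable (order x) (order z) → Adj n x z
  comparable⇒adj x≢z (inj₁ ox∣oz) = x≢z , inj₂ (order∣⇒isPowerOf ox∣oz)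
  comparable⇒adj x≢z (inj₂ oz∣ox) = x≢z , inj₁ (order∣⇒isPowerOf oz∣ox)

  ε : Fin n
  ε = fromℕ< (>-nonZero⁻¹ n)

  toℕ-ε : toℕ ε ≡ 0
  toℕ-ε = toℕ-fromℕ< (>-nonZero⁻¹ n)

  ε-isPowerOf : ∀ x → IsPowerOf n ε x
  ε-isPowerOf x = 0 , trans toℕ-ε (sym (m*n%n≡0 0 n))

  -- Every vertex is adjacent to ε, so distances in the power graph are 0, 1 or 2.
  dist : Fin n → Fin n → ℕ
  dist x z with x ≟ᶠ z | comparable? (order x) (order z)
  ... | yes _ | _     = 0
  ... | no _  | yes _ = 1
  ... | no _  | no _  = 2

  dist-self : ∀ x → dist x x ≡ 0
  dist-self x with x ≟ᶠ x | comparable? (order x) (order x)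
  ... | yes _  | _ = refl
  ... | no x≢x | _ = ⊥-elim (x≢x refl)

  dist≢0 : ∀ {x z} → x ≢ z → dist x z ≢ 0
  dist≢0 {x} {z} x≢z with x ≟ᶠ z | comparable? (order x) (order z)
  ... | yes x≡z | _ = ⊥-elim (x≢z x≡z)
  ... | no _ | yes _ = λ ()
  ... | no _ | no _  = λ ()

  dist-comparable : ∀ {x z} → x ≢ z → Comparable (order x) (order z) → dist x z ≡ 1
  dist-comparable {x} {z} x≢z x~z with x ≟ᶠ z | comparable? (order x) (order z)
  ... | yes x≡z | _ = ⊥-elim (x≢z x≡z)
  ... | no _ | yes _  = refl
  ... | no _ | no x≁z = ⊥-elim (x≁z x~z)

  dist-incomparable : ∀ {x z} → x ≢ z → ¬ Comparable (order x) (order z) → dist x z ≡ 2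
  dist-incomparable {x} {z} x≢z x≁z with x ≟ᶠ z | comparable? (order x) (order z)
  ... | yes x≡z | _ = ⊥-elim (x≢z x≡z)
  ... | no _ | yes x~z = ⊥-elim (x≁z x~z)
  ... | no _ | no _    = refl

  dist≡1⇒comparable : ∀ {x z} → dist x z ≡ 1 → Comparable (order x) (order z)
  dist≡1⇒comparable {x} {z} d≡1 with x ≟ᶠ z | comparable? (order x) (order z)
  ... | no _ | yes x~z = x~z
  ... | yes _ | _ with () ← d≡1
  ... | no _ | no _ with () ← d≡1

  Dist-unique : ∀ {x z d e} → Dist n x z d → Dist n x z e → d ≡ e
  Dist-unique {d = d} {e} (walk-d , shortest-d) (walk-e , shortest-e) with <-cmp d e
  ... | tri< d<e _ _ = ⊥-elim (shortest-e d d<e walk-d)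
  ... | tri≈ _ d≡e _ = d≡e
  ... | tri> _ _ e<d = ⊥-elim (shortest-d e e<d walk-e)

  Dist-dist : ∀ x z → Dist n x z (dist x z)
  Dist-dist x z with x ≟ᶠ z | comparable? (order x) (order z)
  ... | yes refl | _ = here , λ _ ()
  ... | no x≢z | yes x~z = step (comparable⇒adj x≢z x~z) here , shortest
    where
    shortest : ∀ d → d < 1 → ¬ Walk n x z d
    shortest zero _ here = x≢z refl
    shortest (suc _) (s≤s ()) _
  ... | no x≢z | no x≁z =
    step (x≢ε , inj₁ (ε-isPowerOf x)) (step (ε≢z , inj₂ (ε-isPowerOf z)) here) , shortest
    where
    ¬adj : ¬ Adj n x z
    ¬adj adj = x≁z (adj⇒comparable adj)
    x≢ε : x ≢ ε
    x≢ε refl = ¬adj (x≢z , inj₂ (ε-isPowerOf z))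
    ε≢z : ε ≢ z
    ε≢z refl = ¬adj (x≢z , inj₁ (ε-isPowerOf x))
    shortest : ∀ d → d < 2 → ¬ Walk n x z d
    shortest zero _ here = x≢z refl
    shortest (suc zero) _ (step adj here) = ¬adj adj
    shortest (suc (suc _)) (s≤s (s≤s ())) _

  InR⇒dist≢ : ∀ {x y z} → InR n x y z → dist x z ≢ dist y z
  InR⇒dist≢ {x} {y} {z} (d , e , dist-d , dist-e , d≢e) eq =
    d≢e (trans (Dist-unique dist-d (Dist-dist x z)) (trans eq (Dist-unique (Dist-dist y z) dist-e)))

  dist≢⇒InR : ∀ {x y z} → dist x z ≢ dist y z → InR n x y z
  dist≢⇒InR {x} {y} {z} ne = dist x z , dist y z , Dist-dist x z , Dist-dist y z , ne

  order-of-index : ∀ {q d} x → index x ≡ q → n ≡ q * d → order x ≡ d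
  order-of-index {q} {d} x index≡q n≡qd = *-cancelʳ-≡ (order x) d (index x) {{index≢0 x}} (begin
    order x * index x   ≡⟨ sym (n≡order*index x) ⟩
    n                   ≡⟨ n≡qd ⟩
    q * d               ≡⟨ *-comm q d ⟩
    d * q               ≡⟨ cong (d *_) (sym index≡q) ⟩
    d * index x         ∎)
    where open ≡-Reasoning

  IsOrder⇒≡order : ∀ {x a} → IsOrder n x a → a ≡ order x
  IsOrder⇒≡order {x} {a} (0<a , a·x≡0 , minimal) = ≤-antisym a≤order order≤a
    where
    n∣order*x : n ∣ order x * toℕ x
    n∣order*x = subst (_∣ order x * toℕ x) (sym (n≡order*index x))
      (*-monoʳ-∣ (order x) (gcd[m,n]∣m (toℕ x) n))
    a≤order : a ≤ order x
    a≤order = minimal (order x) (>-nonZero⁻¹ (order x) {{order≢0 x}}) (n∣m⇒m%n≡0 _ n n∣order*x)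
    n∣a*index : n ∣ a * index x
    n∣a*index = subst (n ∣_) (sym (c*gcd[m,n]≡gcd[cm,cn] a (toℕ x) n))
      (gcd-greatest (m%n≡0⇒n∣m _ n a·x≡0) (n∣m*n a))
    instance
      a≢0 : NonZero a
      a≢0 = >-nonZero 0<a
    order≤a : order x ≤ a
    order≤a = ∣⇒≤ (*-cancelʳ-∣ (index x) {{index≢0 x}}
      (subst (_∣ a * index x) (n≡order*index x) n∣a*index))

  toℕ≡0⇒order≡1 : ∀ {z} → toℕ z ≡ 0 → order z ≡ 1
  toℕ≡0⇒order≡1 {z} toℕ-z≡0 =
    order-of-index z (trans (cong (λ t → gcd t n) toℕ-z≡0) (gcd-identityˡ n)) (sym (*-identityʳ n))

  order-ε : order ε ≡ 1
  order-ε = toℕ≡0⇒order≡1 toℕ-ε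

  -- An element of order 2 is n/2 itself: its index n/2 divides it, and it lies in (0, n).
  order≡2⇒toℕ≡index : ∀ {z} → order z ≡ 2 → toℕ z ≡ index z
  order≡2⇒toℕ≡index {z} order≡2 with gcd[m,n]∣m (toℕ z) n
  ... | divides zero toℕ-z≡0 with () ← trans (sym order≡2) (toℕ≡0⇒order≡1 toℕ-z≡0)
  ... | divides (suc zero) toℕ-z≡1*index = trans toℕ-z≡1*index (*-identityˡ (index z))
  ... | divides (suc (suc r)) toℕ-z≡r*index = ⊥-elim (<⇒≱ (toℕ<n z) (begin
    n                      ≡⟨ trans (n≡order*index z) (cong (_* index z) order≡2) ⟩
    2 * index z            ≤⟨ *-monoˡ-≤ (index z) {2} {suc (suc r)} (s≤s (s≤s z≤n)) ⟩
    suc (suc r) * index z  ≡⟨ sym toℕ-z≡r*index ⟩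
    toℕ z                  ∎))
    where open ≤-Reasoning

  order≡2-unique : ∀ {z z'} → order z ≡ 2 → order z' ≡ 2 → z ≡ z'
  order≡2-unique {z} {z'} order-z order-z' = toℕ-injective (begin
    toℕ z     ≡⟨ order≡2⇒toℕ≡index order-z ⟩
    index z   ≡⟨ *-cancelˡ-≡ (index z) (index z') 2 same-index ⟩
    index z'  ≡⟨ sym (order≡2⇒toℕ≡index order-z') ⟩
    toℕ z'    ∎)
    where
    open ≡-Reasoning
    same-index : 2 * index z ≡ 2 * index z'
    same-index = trans (cong (_* index z) (sym order-z)) (trans (sym (n≡order*index z))
                   (trans (n≡order*index z') (cong (_* index z') order-z')))

  -- For n = q·d with d > 1, both q and n - q have index q, hence order d.
  module Cofactors {q d} (n≡qd : n ≡ q * d) (1<d : 1 < d) where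

    q∣n : q ∣ n
    q∣n = divides d (trans n≡qd (*-comm q d))

    instance
      q≢0 : NonZero q
      q≢0 = ∣-nonZero q∣n

    q<n : q < n
    q<n = subst (q <_) (sym n≡qd) (m<m*n q d 1<d)

    n∸q<n : n ∸ q < n
    n∸q<n = ∸-monoʳ-< (>-nonZero⁻¹ q) (<⇒≤ q<n)

    order-q : order (fromℕ< q<n) ≡ d
    order-q = order-of-index (fromℕ< q<n)
      (trans (cong (λ t → gcd t n) (toℕ-fromℕ< q<n)) (gcd[m,n]≡m q∣n)) n≡qd

    order-n∸q : order (fromℕ< n∸q<n) ≡ d
    order-n∸q = order-of-index (fromℕ< n∸q<n)
      (trans (cong (λ t → gcd t n) (toℕ-fromℕ< n∸q<n))
        (trans (gcd[n∸m,n]≡gcd[m,n] (<⇒≤ q<n)) (gcd[m,n]≡m q∣n)))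
      n≡qd

    q≡n∸q⇒d≡2 : fromℕ< q<n ≡ fromℕ< n∸q<n → d ≡ 2
    q≡n∸q⇒d≡2 eq = *-cancelˡ-≡ d 2 q (begin
      q * d        ≡⟨ sym n≡qd ⟩
      n            ≡⟨ sym (m∸n+n≡m (<⇒≤ q<n)) ⟩
      n ∸ q + q    ≡⟨ cong (_+ q) (sym q≡n∸q) ⟩
      q + q        ≡⟨ cong (q +_) (sym (*-identityʳ q)) ⟩
      q + q * 1    ≡⟨ sym (*-suc q 1) ⟩
      q * 2        ∎)
      where
      open ≡-Reasoning
      q≡n∸q : q ≡ n ∸ q
      q≡n∸q = trans (sym (toℕ-fromℕ< q<n)) (trans (cong toℕ eq) (toℕ-fromℕ< n∸q<n))

  element-of-order : ∀ {d} → d ∣ n → ∃ λ x → order x ≡ d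
  element-of-order {d} (divides q n≡qd) with d ≟ 1
  ... | yes refl = ε , order-ε
  ... | no d≢1 = fromℕ< q<n , order-q
    where
    instance
      d≢0 : NonZero d
      d≢0 = ∣-nonZero (divides q n≡qd)
    open Cofactors {q} n≡qd (≤∧≢⇒< (>-nonZero⁻¹ d) (λ 1≡d → d≢1 (sym 1≡d)))

  two-elements-of-order : ∀ {d} → d ∣ n → 3 ≤ d → ∃₂ λ y y' → order y ≡ d × order y' ≡ d × y ≢ y'
  two-elements-of-order {d} (divides q n≡qd) 3≤d =
    fromℕ< q<n , fromℕ< n∸q<n , order-q , order-n∸q , λ eq → <⇒≢ 3≤d (sym (q≡n∸q⇒d≡2 eq))
    where open Cofactors {q} n≡qd (≤-trans (s≤s (s≤s z≤n)) 3≤d)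

  element-of-order-avoiding : ∀ {d x y} → d ∣ n → 3 ≤ d → order x ≢ order y →
    ∃ λ z → order z ≡ d × z ≢ x × z ≢ y
  element-of-order-avoiding {d} {x} {y} d∣n 3≤d ox≢oy
    with two-elements-of-order d∣n 3≤d
  ... | z , z' , order-z , order-z' , z≢z' with z ≟ᶠ x | z ≟ᶠ y
  ...   | no z≢x | no z≢y = z , order-z , z≢x , z≢y
  ...   | yes refl | _ = z' , order-z' , ≢-sym z≢z' , λ { refl → ox≢oy (trans order-z (sym order-z')) }
  ...   | no _ | yes refl = z' , order-z' , (λ { refl → ox≢oy (trans order-z' (sym order-z)) }) , ≢-sym z≢z'

  comparable-transfer : ∀ {x y z} → x ≢ z → y ≢ z → dist x z ≡ dist y z →
    Comparable (order z) (order x) → Comparable (order z) (order y)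
  comparable-transfer x≢z y≢z eq z~x =
    swap (dist≡1⇒comparable (trans (sym eq) (dist-comparable x≢z (swap z~x))))

  dist-cong : ∀ {x y z} → x ≢ z → y ≢ z →
    Comparable (order z) (order x) ⇔ Comparable (order z) (order y) → dist x z ≡ dist y z
  dist-cong {x} {y} {z} x≢z y≢z z~x⇔z~y = by-cases (comparable? (order z) (order x))
    where
    by-cases : Dec (Comparable (order z) (order x)) → dist x z ≡ dist y z
    by-cases (yes z~x) = trans (dist-comparable x≢z (swap z~x))
      (sym (dist-comparable y≢z (swap (Equivalence.to z~x⇔z~y z~x))))
    by-cases (no z≁x) = trans (dist-incomparable x≢z (z≁x ∘ swap))
      (sym (dist-incomparable y≢z (z≁x ∘ Equivalence.from z~x⇔z~y ∘ swap)))

  module Involution (w : Fin n) (isOrder-w : IsOrder n w 2) where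

    order-w : order w ≡ 2
    order-w = sym (IsOrder⇒≡order isOrder-w)

    2∣n : 2 ∣ n
    2∣n = subst (_∣ n) order-w (order∣n w)

    order≡2⇒≡w : ∀ {z} → order z ≡ 2 → z ≡ w
    order≡2⇒≡w order-z = order≡2-unique order-z order-w

    ¬Equiv⇒≢ : ∀ {x} → ¬ Equiv n x w → x ≢ w
    ¬Equiv⇒≢ x≉w refl = x≉w (inj₁ λ _ → mk⇔ id id)

    order≡1⊎3≤order : ∀ {z} → z ≢ w → order z ≡ 1 ⊎ 3 ≤ order z
    order≡1⊎3≤order {z} z≢w with order z in order-z
    ... | zero = ⊥-elim (≢-nonZero⁻¹ (order z) {{order≢0 z}} order-z)
    ... | suc zero = inj₁ refl
    ... | suc (suc zero) = ⊥-elim (z≢w (order≡2⇒≡w order-z))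
    ... | suc (suc (suc _)) = inj₂ (s≤s (s≤s (s≤s z≤n)))

    dist-w-comparable : ∀ {x} → x ≢ w → Comparable 2 (order x) → dist x w ≡ 1
    dist-w-comparable x≢w 2~x = dist-comparable x≢w (subst (Comparable _) (sym order-w) (swap 2~x))

    dist-w-incomparable : ∀ {x} → x ≢ w → ¬ Comparable 2 (order x) → dist x w ≡ 2
    dist-w-incomparable x≢w 2≁x = dist-incomparable x≢w (2≁x ∘ swap ∘ subst (Comparable _) order-w)

    ¬Equiv-if-neighbour : ∀ {u} z → u ≢ z → Comparable (order u) (order z) → ¬ Comparable 2 (order z) →
      ¬ Equiv n u w
    ¬Equiv-if-neighbour {u} z u≢z u~z 2≁z = [ same-open , same-closed ]′
      where
      adj-uz : Adj n u z
      adj-uz = comparable⇒adj u≢z u~z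
      ¬adj-wz : ¬ Adj n w z
      ¬adj-wz adj-wz = 2≁z (subst (λ t → Comparable t (order z)) order-w (adj⇒comparable adj-wz))
      same-open : ¬ (∀ v → Adj n u v ⇔ Adj n w v)
      same-open same = ¬adj-wz (Equivalence.to (same z) adj-uz)
      same-closed : ¬ (∀ v → (v ≡ u ⊎ Adj n u v) ⇔ (v ≡ w ⊎ Adj n w v))
      same-closed same with Equivalence.to (same z) (inj₂ adj-uz)
      ... | inj₁ refl = 2≁z (inj₁ (subst (2 ∣_) (sym order-w) ∣-refl))
      ... | inj₂ adj-wz = ¬adj-wz adj-wz

    resolvingPair⇒dist-w≢ : ∀ {x y} → ResolvingPair n w x y → dist x w ≢ dist y w
    resolvingPair⇒dist-w≢ (_ , _ , R) = InR⇒dist≢ (Equivalence.from (R w) (inj₂ (inj₂ refl)))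

    resolvingPair⇒dist≡ : ∀ {x y z} → ResolvingPair n w x y → z ≢ x → z ≢ y → z ≢ w →
      dist x z ≡ dist y z
    resolvingPair⇒dist≡ {x} {y} {z} (_ , _ , R) z≢x z≢y z≢w = decidable-stable (dist x z ≟ dist y z)
      λ dist≢ → [ z≢x , [ z≢y , z≢w ]′ ]′ (Equivalence.to (R z) (dist≢⇒InR dist≢))

    resolvingPair⇒parity : ∀ {x y} → ResolvingPair n w x y →
      Comparable 2 (order x) × ¬ Comparable 2 (order y) ⊎ Comparable 2 (order y) × ¬ Comparable 2 (order x)
    resolvingPair⇒parity {x} {y} rp@(x≉w , y≉w , _) with comparable? 2 (order x) | comparable? 2 (order y)
    ... | yes 2~x | no 2≁y = inj₁ (2~x , 2≁y)
    ... | no 2≁x | yes 2~y = inj₂ (2~y , 2≁x)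
    ... | yes 2~x | yes 2~y = ⊥-elim (resolvingPair⇒dist-w≢ rp
      (trans (dist-w-comparable (¬Equiv⇒≢ x≉w) 2~x) (sym (dist-w-comparable (¬Equiv⇒≢ y≉w) 2~y))))
    ... | no 2≁x | no 2≁y = ⊥-elim (resolvingPair⇒dist-w≢ rp
      (trans (dist-w-incomparable (¬Equiv⇒≢ x≉w) 2≁x) (sym (dist-w-incomparable (¬Equiv⇒≢ y≉w) 2≁y))))

    resolvingPair⇒sameComparableDivisors : ∀ {x y} → ResolvingPair n w x y → order x ≢ order y →
      SameComparableDivisors n (order x) (order y)
    resolvingPair⇒sameComparableDivisors {x} {y} rp ox≢oy d∣n 3≤d
      with element-of-order-avoiding d∣n 3≤d ox≢oy
    ... | z , refl , z≢x , z≢y = mk⇔ (comparable-transfer (≢-sym z≢x) (≢-sym z≢y) eq)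
                                    (comparable-transfer (≢-sym z≢y) (≢-sym z≢x) (sym eq))
      where
      z≢w : z ≢ w
      z≢w refl = <⇒≢ 3≤d (sym order-w)
      eq : dist x z ≡ dist y z
      eq = resolvingPair⇒dist≡ rp z≢x z≢y z≢w

    resolvingOrders-oriented : ∀ {u v} → ¬ Equiv n u w → Comparable 2 (order u) → ¬ Comparable 2 (order v) →
      SameComparableDivisors n (order u) (order v) → ResolvingOrders n (order u) (order v)
    resolvingOrders-oriented {u} {v} u≉w =
      ResolvingOrdersArithmetic.resolvingOrders 2∣n (order∣n u) (order∣n v) (¬Equiv⇒≢ u≉w ∘ order≡2⇒≡w)

    resolvingPair⇒resolvingOrders : ∀ {x y} → ResolvingPair n w x y →
      ResolvingOrders n (order x) (order y) ⊎ ResolvingOrders n (order y) (order x)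
    resolvingPair⇒resolvingOrders {x} {y} rp@(x≉w , y≉w , _) with resolvingPair⇒parity rp
    ... | inj₁ (2~x , 2≁y) = inj₁ (resolvingOrders-oriented {v = y} x≉w 2~x 2≁y
      (resolvingPair⇒sameComparableDivisors rp λ ox≡oy → 2≁y (subst (Comparable 2) ox≡oy 2~x)))
    ... | inj₂ (2~y , 2≁x) = inj₂ (resolvingOrders-oriented {v = x} y≉w 2~y 2≁x (sameComparableDivisors-sym
      (resolvingPair⇒sameComparableDivisors rp λ ox≡oy → 2≁x (subst (Comparable 2) (sym ox≡oy) 2~y))))

    resolvingPair-intro : ∀ {x y} → ¬ Equiv n x w → ¬ Equiv n y w →
      Comparable 2 (order x) → ¬ Comparable 2 (order y) → SameComparableDivisors n (order x) (order y) →
      ResolvingPair n w x y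
    resolvingPair-intro {x} {y} x≉w y≉w 2~x 2≁y same = x≉w , y≉w , λ z → mk⇔ (resolved z) resolving
      where
      x≢w : x ≢ w
      x≢w = ¬Equiv⇒≢ x≉w
      y≢w : y ≢ w
      y≢w = ¬Equiv⇒≢ y≉w
      x≢y : x ≢ y
      x≢y refl = 2≁y 2~x
      dist≡ : ∀ {z} → z ≢ x → z ≢ y → z ≢ w → dist x z ≡ dist y z
      dist≡ {z} z≢x z≢y z≢w =
        dist-cong (≢-sym z≢x) (≢-sym z≢y) ([ order≡1 , same (order∣n z) ]′ (order≡1⊎3≤order z≢w))
        where
        order≡1 : order z ≡ 1 → Comparable (order z) (order x) ⇔ Comparable (order z) (order y)
        order≡1 oz≡1 = mk⇔ (λ _ → inj₁ (subst (_∣ order y) (sym oz≡1) (1∣ _)))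
                           (λ _ → inj₁ (subst (_∣ order x) (sym oz≡1) (1∣ _)))
      resolved : ∀ z → InR n x y z → z ≡ x ⊎ z ≡ y ⊎ z ≡ w
      resolved z r with z ≟ᶠ x | z ≟ᶠ y | z ≟ᶠ w
      ... | yes z≡x | _ | _ = inj₁ z≡x
      ... | no _ | yes z≡y | _ = inj₂ (inj₁ z≡y)
      ... | no _ | no _ | yes z≡w = inj₂ (inj₂ z≡w)
      ... | no z≢x | no z≢y | no z≢w = ⊥-elim (InR⇒dist≢ r (dist≡ z≢x z≢y z≢w))
      resolving : ∀ {z} → z ≡ x ⊎ z ≡ y ⊎ z ≡ w → InR n x y z
      resolving (inj₁ refl) = dist≢⇒InR λ eq → dist≢0 (≢-sym x≢y) (trans (sym eq) (dist-self x))
      resolving (inj₂ (inj₁ refl)) = dist≢⇒InR λ eq → dist≢0 x≢y (trans eq (dist-self y))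
      resolving (inj₂ (inj₂ refl)) = dist≢⇒InR λ eq →
        1≢2 (trans (sym (dist-w-comparable x≢w 2~x)) (trans eq (dist-w-incomparable y≢w 2≁y)))
        where
        1≢2 : 1 ≢ 2
        1≢2 ()

    -- The second element y' of order b is a neighbour of both x and y but not of w.
    isResolvingInvolution-if : ∀ {a b} → a ∣ n → b ∣ n → Comparable a b → Comparable 2 a → ¬ Comparable 2 b →
      SameComparableDivisors n a b → IsResolvingInvolution n w
    isResolvingInvolution-if a∣n b∣n a~b 2~a 2≁b same
      with element-of-order a∣n | two-elements-of-order b∣n (¬comparable-2⇒3≤ {{∣-nonZero b∣n}} 2≁b)
    ... | x , refl | y , y' , refl , order-y' , y≢y' =
      isOrder-w , x , y , resolvingPair-intro x≉w y≉w 2~a 2≁b same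
      where
      2≁y' : ¬ Comparable 2 (order y')
      2≁y' = 2≁b ∘ subst (Comparable 2) order-y'
      x≢y' : x ≢ y'
      x≢y' refl = 2≁y' 2~a
      x≉w : ¬ Equiv n x w
      x≉w = ¬Equiv-if-neighbour y' x≢y' (subst (Comparable (order x)) (sym order-y') a~b) 2≁y'
      y≉w : ¬ Equiv n y w
      y≉w = ¬Equiv-if-neighbour y' y≢y' (inj₁ (subst (order y ∣_) (sym order-y') ∣-refl)) 2≁y'

    resolvingPair⇒orders : ∀ {x y a b} → ResolvingPair n w x y → IsOrder n x a → IsOrder n y b →
      ResolvingOrders n a b ⊎ ResolvingOrders n b a
    resolvingPair⇒orders rp isOrder-x isOrder-y
      rewrite IsOrder⇒≡order isOrder-x | IsOrder⇒≡order isOrder-y = resolvingPair⇒resolvingOrders rp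

    isResolvingInvolution-2p^m : ∀ {p m} → Prime p → ¬ 2 ∣ p → 1 ≤ m → n ≡ 2 * p ^ m →
      IsResolvingInvolution n w
    isResolvingInvolution-2p^m {p} {m} pp 2∤p 1≤m n≡2p^m =
      isResolvingInvolution-if (1∣ n) (subst (p ∣_) (sym n≡2p^m) (∣n⇒∣m*n 2 (p∣p^m 1≤m)))
        (inj₁ (1∣ p)) (inj₂ (1∣ 2)) (odd-prime⇒2≁ pp 2∤p)
        (sameComparableDivisors-2p^m {m = m} pp n≡2p^m)

    isResolvingInvolution-2^mp : ∀ {p m} → Prime p → ¬ 2 ∣ p → 1 ≤ m → n ≡ 2 ^ m * p →
      IsResolvingInvolution n w
    isResolvingInvolution-2^mp {p} {m} pp 2∤p 1≤m n≡2^mp =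
      isResolvingInvolution-if (subst (2 * p ∣_) (sym n≡2^mp) (*-monoˡ-∣ p (p∣p^m 1≤m)))
        (subst (p ∣_) (sym n≡2^mp) (n∣m*n (2 ^ m))) (inj₂ (n∣m*n 2)) (inj₁ (m∣m*n p))
        (odd-prime⇒2≁ pp 2∤p) (sameComparableDivisors-2^mp {m = m} pp 2∤p n≡2^mp)

proposition3p15 : (n : ℕ) .{{_ : NonZero n}} → 2 ∣ n → (w : Fin n) → IsOrder n w 2 →
      (IsResolvingInvolution n w →
        ∃₂ λ p m → Prime p × ¬ (2 ∣ p) × 1 ≤ m × (n ≡ 2 * p ^ m ⊎ n ≡ 2 ^ m * p))
    × (∀ p m → Prime p → ¬ (2 ∣ p) → 1 ≤ m → n ≡ 2 * p ^ m →
        IsResolvingInvolution n w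
        × (∀ x y → ResolvingPair n w x y → ∀ a b → IsOrder n x a → IsOrder n y b →
            SameSet a b 1 p ⊎ SameSet a b (2 * p ^ m) p))
    × (∀ p m → Prime p → ¬ (2 ∣ p) → 2 ≤ m → n ≡ 2 ^ m * p →
        IsResolvingInvolution n w
        × (∀ x y → ResolvingPair n w x y → ∀ a b → IsOrder n x a → IsOrder n y b →
            SameSet a b (2 * p) p))
-- The hypothesis 2 ∣ n is implied by the existence of w.
proposition3p15 n _ w isOrder-w =
    (λ (_ , x , y , rp) →
        [ resolvingOrders⇒shape , resolvingOrders⇒shape ]′ (resolvingPair⇒resolvingOrders rp))
  , (λ p m pp 2∤p 1≤m n≡2p^m →
        isResolvingInvolution-2p^m pp 2∤p 1≤m n≡2p^m
      , λ x y rp a b isOrder-x isOrder-y →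
          resolvingOrders-2p^m {m = m} pp 2∤p n≡2p^m (resolvingPair⇒orders rp isOrder-x isOrder-y))
  , (λ p m pp 2∤p 2≤m n≡2^mp →
        isResolvingInvolution-2^mp pp 2∤p (≤-trans (s≤s z≤n) 2≤m) n≡2^mp
      , λ x y rp a b isOrder-x isOrder-y →
          resolvingOrders-2^mp {m = m} pp 2≤m n≡2^mp (resolvingPair⇒orders rp isOrder-x isOrder-y))
  where
  open CyclicGroup n
  open Involution w isOrder-w
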